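{- Let $q$ be a prime power and $t\ge2$, $m\ge2$ integers, and let $\varepsilon=(t-1)\bmod q$. Define $$R_2=q^{2m+t-1}\frac{q^m+q^{m+1}-t+q(t-3-\varepsilon)+(1+\varepsilon)^2}{(1+q^m(q+1)+q(t-3)-t+\varepsilon)(1+q^m(q+1)+q(t-2)-t+\varepsilon)}.$$ Then $$R_2\le\frac{q^{2m+t-1}}{(q+1)(q^m-1)+(t-1)(q-1)}.$$
   Context: Setting: $\mathbf{n}=(2,1,\dots,1)$, $\mathbf{m}=(m,1,\dots,1)$ of length $t$, with the sum-rank metric on $\operatorname{Mat}(\mathbf{n},\mathbf{m},\mathbb{F}_q)=\bigoplus_i\mathbb{F}_q^{n_i\times m_i}$. $R_2$ is the Ratio-Type eigenvalue upper bound on $A_q(\mathbf{n},\mathbf{m},3)$ (largest size of a code with minimum sum-rank distance at least $3$), and the right-hand side is the Sphere-Packing bound value $|\operatorname{Mat}(\mathbf{n},\mathbf{m},\mathbb{F}_q)|/V_1$ with $V_1$ the size of a sum-rank ball of radius $1$. -}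

module Defs where

open import Data.Nat as ℕ using (ℕ; zero; suc)
open import Data.Nat.DivMod using (_%_)
open import Data.Nat.Primality using (Prime)
open import Data.Integer as ℤ using (ℤ; +_)
open import Data.Product using (∃; ∃-syntax; _×_)
open import Relation.Binary.PropositionalEquality using (_≡_)
open import Relation.Nullary using (yes; no)
open import Data.Rational as ℚ using (ℚ; 0ℚ; _÷_; ≢-nonZero)
open import Data.Rational.Properties using (_≟_)

IsPrimePower : ℕ → Set
IsPrimePower q = ∃[ p ] ∃[ k ] (Prime p × q ≡ p ℕ.^ suc k)

-- ε = (t - 1) mod q  (q = 0 never occurs for a prime power; junk value 0)
eps : ℕ → ℕ → ℕ
eps zero    t = 0
eps (suc q) t = (t ℕ.∸ 1) % suc q

⟦_⟧ : ℤ → ℚ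
⟦ z ⟧ = ℚ._/_ z 1

-- division of rationals, total: junk value 0 when the divisor is 0
-- (all divisors occurring below are positive under the hypotheses)
_÷'_ : ℚ → ℚ → ℚ
p ÷' r with r ≟ 0ℚ
... | yes _  = 0ℚ
... | no r≢0 = _÷_ p r {{≢-nonZero r≢0}}

module _ (q t m : ℕ) where
  private
    Q T E : ℤ
    Q = + q
    T = + t
    E = + eps q t
    Qm : ℤ
    Qm = + (q ℕ.^ m)

  -- q^(2m+t-1)  (t ≥ 2, so no truncation)
  bigPow : ℚ
  bigPow = ⟦ + (q ℕ.^ (2 ℕ.* m ℕ.+ t ℕ.∸ 1)) ⟧

  R2num : ℤ
  R2num = Qm ℤ.+ Qm ℤ.* Q ℤ.- T ℤ.+ Q ℤ.* (T ℤ.- + 3 ℤ.- E) ℤ.+ (+ 1 ℤ.+ E) ℤ.* (+ 1 ℤ.+ E)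

  R2den1 : ℤ
  R2den1 = + 1 ℤ.+ Qm ℤ.* (Q ℤ.+ + 1) ℤ.+ Q ℤ.* (T ℤ.- + 3) ℤ.- T ℤ.+ E

  R2den2 : ℤ
  R2den2 = + 1 ℤ.+ Qm ℤ.* (Q ℤ.+ + 1) ℤ.+ Q ℤ.* (T ℤ.- + 2) ℤ.- T ℤ.+ E

  R2 : ℚ
  R2 = bigPow ℚ.* (⟦ R2num ⟧ ÷' ⟦ R2den1 ℤ.* R2den2 ⟧)

  -- size of a sum-rank ball of radius 1: (q+1)(q^m-1) + (t-1)(q-1)
  V1 : ℤ
  V1 = (Q ℤ.+ + 1) ℤ.* (Qm ℤ.- + 1) ℤ.+ (T ℤ.- + 1) ℤ.* (Q ℤ.- + 1)

  SP : ℚ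
  SP = bigPow ÷' ⟦ V1 ⟧

{-# OPTIONS --safe #-}
-- Put D = R2den1 and s = q − 1 − ε, which is nonnegative because ε = (t − 1) mod q < q.
-- Then V₁ = D + s, the numerator of R₂ is D − ε s and its second denominator factor is
-- D + s + 1 + ε, so R₂ ≤ SP amounts to (D + s)(D − ε s) ≤ D (D + s + 1 + ε); the
-- difference of the two sides is D (1 + ε) + ε s (D + s) ≥ 0. All divisions are genuine
-- because D = (q + 1)(q^m − 2) + (t − 1)(q − 1) + ε + 2 > 0.
module Submission where

open import Defs
open import Data.Nat using (ℕ; _≤_)
open import Data.Rational using () renaming (_≤_ to _≤ℚ_)

open import Data.Nat as ℕ using (suc; s≤s; z≤n; NonZero)
import Data.Nat.Properties as ℕ
open import Data.Nat.DivMod using (m%n<n)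
open import Data.Nat.Primality using (prime⇒nonTrivial)
open import Data.Integer as ℤ using (ℤ; +_; 0ℤ; +≤+; +<+)
import Data.Integer.Properties as ℤ
open import Data.Integer.Tactic.RingSolver using (solve-∀)
open import Data.Rational as ℚ using (ℚ; 0ℚ; _÷_; 1/_; toℚᵘ; NonNegative; Positive)
import Data.Rational.Properties as ℚ
import Data.Rational.Unnormalised as ℚᵘ
import Data.Rational.Unnormalised.Properties as ℚᵘ
open import Data.Product using (_,_)
open import Function using (_$_)
open import Relation.Binary.PropositionalEquality
open import Relation.Nullary using (yes; no; contradiction)

2≤m⇒2≤m^n : ∀ {a} n → 2 ≤ a → 1 ≤ n → 2 ≤ a ℕ.^ n
2≤m⇒2≤m^n {a@(suc _)} n 2≤a 1≤n = begin
  2          ≤⟨ 2≤a ⟩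
  a          ≡⟨ ℕ.^-identityʳ a ⟨
  a ℕ.^ 1    ≤⟨ ℕ.^-monoʳ-≤ a 1≤n ⟩
  a ℕ.^ n    ∎
  where open ℕ.≤-Reasoning

primePower≥2 : ∀ {q} → IsPrimePower q → 2 ≤ q
primePower≥2 (p , k , p-prime , refl) =
  2≤m⇒2≤m^n (suc k) (ℕ.nonTrivial⇒n>1 p {{prime⇒nonTrivial p-prime}}) (s≤s z≤n)

eps<q : ∀ q t .{{_ : NonZero q}} → eps q t ℕ.< q
eps<q (suc q) t = m%n<n (t ℕ.∸ 1) (suc q)

⟦⟧≃ : ∀ z → toℚᵘ ⟦ z ⟧ ℚᵘ.≃ ℚᵘ.mkℚᵘ z 0
⟦⟧≃ z = ℚ.toℚᵘ-fromℚᵘ (ℚᵘ.mkℚᵘ z 0)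

⟦⟧-* : ∀ a b → ⟦ a ⟧ ℚ.* ⟦ b ⟧ ≡ ⟦ a ℤ.* b ⟧
⟦⟧-* a b = ℚ.toℚᵘ-injective $ begin
  toℚᵘ (⟦ a ⟧ ℚ.* ⟦ b ⟧)           ≈⟨ ℚ.toℚᵘ-homo-* ⟦ a ⟧ ⟦ b ⟧ ⟩
  toℚᵘ ⟦ a ⟧ ℚᵘ.* toℚᵘ ⟦ b ⟧        ≈⟨ ℚᵘ.*-cong (⟦⟧≃ a) (⟦⟧≃ b) ⟩
  ℚᵘ.mkℚᵘ (a ℤ.* b) 0              ≈⟨ ⟦⟧≃ (a ℤ.* b) ⟨
  toℚᵘ ⟦ a ℤ.* b ⟧                 ∎
  where open ℚᵘ.≃-Reasoning

⟦⟧-mono-≤ : ∀ {a b} → a ℤ.≤ b → ⟦ a ⟧ ℚ.≤ ⟦ b ⟧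
⟦⟧-mono-≤ {a} {b} a≤b = ℚ.toℚᵘ-cancel-≤ $ begin
  toℚᵘ ⟦ a ⟧           ≃⟨ ⟦⟧≃ a ⟩
  ℚᵘ.mkℚᵘ a 0          ≤⟨ ℚᵘ.*≤* (subst₂ ℤ._≤_ (sym (ℤ.*-identityʳ a)) (sym (ℤ.*-identityʳ b)) a≤b) ⟩
  ℚᵘ.mkℚᵘ b 0          ≃⟨ ⟦⟧≃ b ⟨
  toℚᵘ ⟦ b ⟧           ∎
  where open ℚᵘ.≤-Reasoning

⟦⟧-pos : ∀ i .{{_ : ℤ.Positive i}} → Positive ⟦ i ⟧
⟦⟧-pos (+ suc n) = ℚ.normalize-pos (suc n) 1

⟦⟧-nonNeg : ∀ n → NonNegative ⟦ + n ⟧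
⟦⟧-nonNeg n = ℚ.normalize-nonNeg n 1

÷'-pos : ∀ p r .{{_ : Positive r}} → p ÷' r ≡ (p ÷ r) {{ℚ.pos⇒nonZero r}}
÷'-pos p r with r ℚ.≟ 0ℚ
... | yes refl = contradiction (ℚ.positive⁻¹ r) (ℚ.<-irrefl refl)
... | no _     = refl

÷-≤-1/ : ∀ n d v .{{_ : Positive d}} .{{_ : Positive v}} → v ℚ.* n ℚ.≤ d →
         (n ÷ d) {{ℚ.pos⇒nonZero d}} ℚ.≤ (1/ v) {{ℚ.pos⇒nonZero v}}
÷-≤-1/ n d v vn≤d = begin
  n ℚ.* 1/ d                     ≡⟨ cong (ℚ._* 1/ d) (cancelˡ v n) ⟨
  (1/ v ℚ.* (v ℚ.* n)) ℚ.* 1/ d  ≤⟨ ℚ.*-monoʳ-≤-nonNeg (1/ d) (ℚ.*-monoˡ-≤-nonNeg (1/ v) vn≤d) ⟩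
  (1/ v ℚ.* d) ℚ.* 1/ d          ≡⟨ cancelʳ (1/ v) d ⟩
  1/ v                           ∎
  where
  open ℚ.≤-Reasoning
  instance
    d≢0 : ℚ.NonZero d
    d≢0 = ℚ.pos⇒nonZero d
    v≢0 : ℚ.NonZero v
    v≢0 = ℚ.pos⇒nonZero v
    1/d≥0 : NonNegative (1/ d)
    1/d≥0 = ℚ.pos⇒nonNeg (1/ d) {{ℚ.1/pos⇒pos d}}
    1/v≥0 : NonNegative (1/ v)
    1/v≥0 = ℚ.pos⇒nonNeg (1/ v) {{ℚ.1/pos⇒pos v}}
  cancelˡ : ∀ p r .{{_ : ℚ.NonZero p}} → 1/ p ℚ.* (p ℚ.* r) ≡ r
  cancelˡ p r = trans (sym (ℚ.*-assoc (1/ p) p r))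
                      (trans (cong (ℚ._* r) (ℚ.*-inverseˡ p)) (ℚ.*-identityˡ r))
  cancelʳ : ∀ r p .{{_ : ℚ.NonZero p}} → (r ℚ.* p) ℚ.* 1/ p ≡ r
  cancelʳ r p = trans (ℚ.*-assoc r p (1/ p))
                      (trans (cong (r ℚ.*_) (ℚ.*-inverseʳ p)) (ℚ.*-identityʳ r))

*-÷'-≤-÷' : ∀ b n d v .{{_ : NonNegative b}} .{{_ : Positive d}} .{{_ : Positive v}} →
            v ℚ.* n ℚ.≤ d → b ℚ.* (n ÷' d) ℚ.≤ b ÷' v
*-÷'-≤-÷' b n d v vn≤d =
  subst₂ ℚ._≤_ (cong (b ℚ.*_) (sym (÷'-pos n d))) (sym (÷'-pos b v))
         (ℚ.*-monoˡ-≤-nonNeg b (÷-≤-1/ n d v vn≤d))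

⟦⟧-*-÷'-≤-÷' : ∀ b n d v .{{_ : ℤ.Positive d}} .{{_ : ℤ.Positive v}} → v ℤ.* n ℤ.≤ d →
               ⟦ + b ⟧ ℚ.* (⟦ n ⟧ ÷' ⟦ d ⟧) ℚ.≤ ⟦ + b ⟧ ÷' ⟦ v ⟧
⟦⟧-*-÷'-≤-÷' b n d v vn≤d =
  *-÷'-≤-÷' ⟦ + b ⟧ ⟦ n ⟧ ⟦ d ⟧ ⟦ v ⟧ {{⟦⟧-nonNeg b}} {{⟦⟧-pos d}} {{⟦⟧-pos v}}
            (subst (ℚ._≤ ⟦ d ⟧) (sym (⟦⟧-* v n)) (⟦⟧-mono-≤ vn≤d))

+-nonNeg : ∀ {i j} → 0ℤ ℤ.≤ i → 0ℤ ℤ.≤ j → 0ℤ ℤ.≤ i ℤ.+ j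
+-nonNeg = ℤ.+-mono-≤

*-nonNeg : ∀ {i j} → 0ℤ ℤ.≤ i → 0ℤ ℤ.≤ j → 0ℤ ℤ.≤ i ℤ.* j
*-nonNeg {+ m} {+ n} _ _ = subst (0ℤ ℤ.≤_) (ℤ.pos-* m n) (+≤+ z≤n)

module _ (D R E : ℤ) (0<D : 0ℤ ℤ.< D) (0≤R : 0ℤ ℤ.≤ R) (0≤E : 0ℤ ℤ.≤ E) where
  private
    0≤D : 0ℤ ℤ.≤ D
    0≤D = ℤ.<⇒≤ 0<D

  gap-≤ : (D ℤ.+ R) ℤ.* (D ℤ.- E ℤ.* R) ℤ.≤ D ℤ.* (D ℤ.+ R ℤ.+ + 1 ℤ.+ E)
  gap-≤ = subst ((D ℤ.+ R) ℤ.* (D ℤ.- E ℤ.* R) ℤ.≤_) (sym (gap D R E))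
                (ℤ.i≤i+j _ _ {{ℤ.nonNegative 0≤gap}})
    where
    gap : ∀ D R E → D ℤ.* (D ℤ.+ R ℤ.+ + 1 ℤ.+ E)
                    ≡ (D ℤ.+ R) ℤ.* (D ℤ.- E ℤ.* R) ℤ.+ (D ℤ.* (+ 1 ℤ.+ E) ℤ.+ E ℤ.* R ℤ.* (D ℤ.+ R))
    gap = solve-∀
    0≤gap : 0ℤ ℤ.≤ D ℤ.* (+ 1 ℤ.+ E) ℤ.+ E ℤ.* R ℤ.* (D ℤ.+ R)
    0≤gap = +-nonNeg (*-nonNeg 0≤D (+-nonNeg (+≤+ z≤n) 0≤E))
                     (*-nonNeg (*-nonNeg 0≤E 0≤R) (+-nonNeg 0≤D 0≤R))

  private
    0<D+R : 0ℤ ℤ.< D ℤ.+ R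
    0<D+R = ℤ.+-mono-<-≤ 0<D 0≤R

    0<D*[D+R+1+E] : 0ℤ ℤ.< D ℤ.* (D ℤ.+ R ℤ.+ + 1 ℤ.+ E)
    0<D*[D+R+1+E] = ℤ.*-monoʳ-<-pos _ {{ℤ.positive 0<D+R+1+E}} 0<D
      where
      0<D+R+1+E : 0ℤ ℤ.< D ℤ.+ R ℤ.+ + 1 ℤ.+ E
      0<D+R+1+E = ℤ.+-mono-<-≤ (ℤ.+-mono-<-≤ 0<D+R (+≤+ z≤n)) 0≤E

  ratio-≤-sphere : ∀ b {n d v} → n ≡ D ℤ.- E ℤ.* R → d ≡ D ℤ.+ R ℤ.+ + 1 ℤ.+ E → v ≡ D ℤ.+ R →
                   ⟦ + b ⟧ ℚ.* (⟦ n ⟧ ÷' ⟦ D ℤ.* d ⟧) ℚ.≤ ⟦ + b ⟧ ÷' ⟦ v ⟧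
  ratio-≤-sphere b refl refl refl =
    ⟦⟧-*-÷'-≤-÷' b _ _ _ {{ℤ.positive 0<D*[D+R+1+E]}} {{ℤ.positive 0<D+R}} gap-≤

module _ (q t : ℕ) where

  ε slack : ℤ
  ε = + eps q t
  slack = + q ℤ.- + suc (eps q t)

  0≤slack : .{{_ : NonZero q}} → 0ℤ ℤ.≤ slack
  0≤slack = ℤ.i≤j⇒0≤j-i (+≤+ (eps<q q t))

module _ (q t m : ℕ) where

  R2den1≡ : R2den1 q t m ≡
            (+ q ℤ.+ + 1) ℤ.* (+ (q ℕ.^ m) ℤ.- + 2) ℤ.+ (+ t ℤ.- + 1) ℤ.* (+ q ℤ.- + 1) ℤ.+ ε q t ℤ.+ + 2
  R2den1≡ = identity (+ q) (+ t) (+ (q ℕ.^ m)) (ε q t)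
    where
    identity : ∀ Q T M E →
      + 1 ℤ.+ M ℤ.* (Q ℤ.+ + 1) ℤ.+ Q ℤ.* (T ℤ.- + 3) ℤ.- T ℤ.+ E
      ≡ (Q ℤ.+ + 1) ℤ.* (M ℤ.- + 2) ℤ.+ (T ℤ.- + 1) ℤ.* (Q ℤ.- + 1) ℤ.+ E ℤ.+ + 2
    identity = solve-∀

  R2num≡ : R2num q t m ≡ R2den1 q t m ℤ.- ε q t ℤ.* slack q t
  R2num≡ = identity (+ q) (+ t) (+ (q ℕ.^ m)) (ε q t)
    where
    identity : ∀ Q T M E →
      M ℤ.+ M ℤ.* Q ℤ.- T ℤ.+ Q ℤ.* (T ℤ.- + 3 ℤ.- E) ℤ.+ (+ 1 ℤ.+ E) ℤ.* (+ 1 ℤ.+ E)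
      ≡ (+ 1 ℤ.+ M ℤ.* (Q ℤ.+ + 1) ℤ.+ Q ℤ.* (T ℤ.- + 3) ℤ.- T ℤ.+ E) ℤ.- E ℤ.* (Q ℤ.- (+ 1 ℤ.+ E))
    identity = solve-∀

  R2den2≡ : R2den2 q t m ≡ R2den1 q t m ℤ.+ slack q t ℤ.+ + 1 ℤ.+ ε q t
  R2den2≡ = identity (+ q) (+ t) (+ (q ℕ.^ m)) (ε q t)
    where
    identity : ∀ Q T M E →
      + 1 ℤ.+ M ℤ.* (Q ℤ.+ + 1) ℤ.+ Q ℤ.* (T ℤ.- + 2) ℤ.- T ℤ.+ E
      ≡ (+ 1 ℤ.+ M ℤ.* (Q ℤ.+ + 1) ℤ.+ Q ℤ.* (T ℤ.- + 3) ℤ.- T ℤ.+ E) ℤ.+ (Q ℤ.- (+ 1 ℤ.+ E)) ℤ.+ + 1 ℤ.+ E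
    identity = solve-∀

  V1≡ : V1 q t m ≡ R2den1 q t m ℤ.+ slack q t
  V1≡ = identity (+ q) (+ t) (+ (q ℕ.^ m)) (ε q t)
    where
    identity : ∀ Q T M E →
      (Q ℤ.+ + 1) ℤ.* (M ℤ.- + 1) ℤ.+ (T ℤ.- + 1) ℤ.* (Q ℤ.- + 1)
      ≡ (+ 1 ℤ.+ M ℤ.* (Q ℤ.+ + 1) ℤ.+ Q ℤ.* (T ℤ.- + 3) ℤ.- T ℤ.+ E) ℤ.+ (Q ℤ.- (+ 1 ℤ.+ E))
    identity = solve-∀

  0<R2den1 : 1 ≤ q → 1 ≤ t → 2 ≤ q ℕ.^ m → 0ℤ ℤ.< R2den1 q t m
  0<R2den1 1≤q 1≤t 2≤qᵐ = subst (0ℤ ℤ.<_) (sym R2den1≡) (ℤ.+-mono-≤-< 0≤rest (+<+ (s≤s z≤n)))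
    where
    0≤rest : 0ℤ ℤ.≤ (+ q ℤ.+ + 1) ℤ.* (+ (q ℕ.^ m) ℤ.- + 2) ℤ.+ (+ t ℤ.- + 1) ℤ.* (+ q ℤ.- + 1) ℤ.+ ε q t
    0≤rest = +-nonNeg (+-nonNeg (*-nonNeg (ℤ.nonNegative⁻¹ (+ (q ℕ.+ 1))) (ℤ.i≤j⇒0≤j-i (+≤+ 2≤qᵐ)))
                                (*-nonNeg (ℤ.i≤j⇒0≤j-i (+≤+ 1≤t)) (ℤ.i≤j⇒0≤j-i (+≤+ 1≤q))))
                      (ℤ.nonNegative⁻¹ (ε q t))

lemma5p6 : (q t m : ℕ) → IsPrimePower q → 2 ≤ t → 2 ≤ m →
    R2 q t m ≤ℚ SP q t m
lemma5p6 q t m q-primePower 2≤t 2≤m =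
  ratio-≤-sphere (R2den1 q t m) (slack q t) (ε q t)
    (0<R2den1 q t m 1≤q (ℕ.<⇒≤ 2≤t) (2≤m⇒2≤m^n m 2≤q (ℕ.<⇒≤ 2≤m)))
    (0≤slack q t {{ℕ.>-nonZero 1≤q}}) (ℤ.nonNegative⁻¹ (ε q t))
    (q ℕ.^ (2 ℕ.* m ℕ.+ t ℕ.∸ 1)) (R2num≡ q t m) (R2den2≡ q t m) (V1≡ q t m)
  where
  2≤q : 2 ≤ q
  2≤q = primePower≥2 q-primePower
  1≤q : 1 ≤ q
  1≤q = ℕ.<⇒≤ 2≤q
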